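{- Let $T$ be a tree on $n \geq 4$ vertices which is a path, and let $H$ be the graph returned by the procedure Path_Augmentation applied to $T$. Then every vertex $v$ of $H$ satisfies $\deg_H(v) \geq 3$.
   Context: Procedure Path_Augmentation: the input is a tree $T$ that is a path on $n$ vertices, written $v_1, v_2, \ldots, v_n$ with $v_i$ adjacent to $v_{i+1}$ for $1\le i\le n-1$. "Adding" an edge means inserting it into the current graph (initially $T$) and into the output set $E_{ca}$ (initially empty). First add the edge $\{v_1,v_n\}$. Then, for $i=1,2,\ldots,\lceil n/2\rceil$ in this order: if the current degree of $v_i$ equals 2, add the edge $\{v_i, v_{\lfloor n/2\rfloor + i}\}$. Finally, if the current degree of $v_n$ equals 2, add the edge $\{v_n, v_{\lfloor n/2\rfloor+1}\}$. The procedure returns the resulting graph $H$ and the set $E_{ca}$. -}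

module Defs where

open import Data.Nat using (ℕ; zero; suc; _+_; _∸_; _/_; _≡ᵇ_)
open import Data.Bool using (Bool; true; false; if_then_else_)
open import Data.List using (List; []; _∷_; _++_; map; upTo)
open import Data.Nat.ListAction using (sum)
open import Data.Product using (_×_; _,_)

-- A (multi)graph on vertices v₁,…,vₙ, identified with the naturals 1,…,n,
-- is given by its list of edges; an edge {a,b} is a pair (a , b).
Edge : Set
Edge = ℕ × ℕ

incid : ℕ → Edge → ℕ
incid v (a , b) = (if a ≡ᵇ v then 1 else 0) + (if b ≡ᵇ v then 1 else 0)

deg : List Edge → ℕ → ℕ
deg E v = sum (map (incid v) E)

pathEdges : ℕ → List Edge
pathEdges n = map (λ k → (suc k , suc (suc k))) (upTo (n ∸ 1))

half : ℕ → ℕ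
half n = n / 2

halfCeil : ℕ → ℕ
halfCeil n = (n + 1) / 2

addIfDeg2 : List Edge → ℕ → ℕ → List Edge
addIfDeg2 G a b = if deg G a ≡ᵇ 2 then G ++ ((a , b) ∷ []) else G

loop : ℕ → List Edge → List ℕ → List Edge
loop n G []       = G
loop n G (i ∷ is) = loop n (addIfDeg2 G i (half n + i)) is

pathAugmentation : ℕ → List Edge
pathAugmentation n =
  let G₀ = pathEdges n ++ ((1 , n) ∷ [])
      G₁ = loop n G₀ (map suc (upTo (halfCeil n)))
  in addIfDeg2 G₁ n (half n + 1)

-- Adding {v₁,vₙ} closes the path into a cycle, so every vertex starts with degree 2.
-- When the loop reaches i ≤ ⌊n/2⌋, the vertex vᵢ is still untouched, since earlier steps
-- involve only smaller vertices and vertices beyond ⌊n/2⌋; hence the edge {vᵢ, v_{⌊n/2⌋+i}}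
-- is added and both endpoints reach degree 3.  As n ≤ 2⌊n/2⌋ + 1, every vertex other than
-- vₙ is of the form vᵢ or v_{⌊n/2⌋+i} with 1 ≤ i ≤ ⌊n/2⌋, and vₙ is handled by the last step.
module Submission where

open import Defs
open import Data.Nat using (ℕ; _≤_)
open import Data.Nat.Base
  using (zero; suc; _+_; _∸_; _<_; _≤′_; ≤′-refl; ≤′-step; _≡ᵇ_; z≤n; s≤s; s≤s⁻¹; ⌊_/2⌋; ⌈_/2⌉)
open import Data.Nat.Properties
open import Data.Nat.DivMod using (m/n≡1+[m∸n]/n)
open import Data.Nat.ListAction using (sum)
open import Data.Nat.ListAction.Properties using (sum-++)
open import Data.Bool using (true; false)
open import Data.List using (List; []; _∷_; _++_; map; upTo)
open import Data.List.Properties using (map-++; upTo-∷ʳ)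
open import Data.Sum using (inj₁; inj₂)
open import Data.Product using (∃-syntax; _×_; _,_)
open import Relation.Binary.PropositionalEquality
open import Relation.Nullary using (yes; no)
open import Relation.Nullary.Decidable using (dec-true; dec-false)

-- does (m ≟ n) computes to m ≡ᵇ n.
≡ᵇ-refl : ∀ n → (n ≡ᵇ n) ≡ true
≡ᵇ-refl n = dec-true (n ≟ n) refl

≢⇒≡ᵇ≡false : ∀ {m n} → m ≢ n → (m ≡ᵇ n) ≡ false
≢⇒≡ᵇ≡false {m} {n} = dec-false (m ≟ n)

incid-≢ : ∀ a b v → a ≢ v → b ≢ v → incid v (a , b) ≡ 0
incid-≢ a b v a≢v b≢v rewrite ≢⇒≡ᵇ≡false a≢v | ≢⇒≡ᵇ≡false b≢v = refl

incid-fst≢snd : ∀ a b → b ≢ a → incid a (a , b) ≡ 1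
incid-fst≢snd a b b≢a rewrite ≡ᵇ-refl a | ≢⇒≡ᵇ≡false b≢a = refl

incid-snd≢fst : ∀ a b → a ≢ b → incid b (a , b) ≡ 1
incid-snd≢fst a b a≢b rewrite ≡ᵇ-refl b | ≢⇒≡ᵇ≡false a≢b = refl

incid-fst-≥1 : ∀ a b → 1 ≤ incid a (a , b)
incid-fst-≥1 a b rewrite ≡ᵇ-refl a = s≤s z≤n

incid-snd-≥1 : ∀ a b → 1 ≤ incid b (a , b)
incid-snd-≥1 a b rewrite ≡ᵇ-refl b = m≤n+m 1 _

deg-++ : ∀ G G′ v → deg (G ++ G′) v ≡ deg G v + deg G′ v
deg-++ G G′ v = begin
  sum (map (incid v) (G ++ G′))                 ≡⟨ cong sum (map-++ (incid v) G G′) ⟩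
  sum (map (incid v) G ++ map (incid v) G′)     ≡⟨ sum-++ (map (incid v) G) (map (incid v) G′) ⟩
  deg G v + deg G′ v                            ∎
  where open ≡-Reasoning

deg-∷ʳ : ∀ G e v → deg (G ++ e ∷ []) v ≡ deg G v + incid v e
deg-∷ʳ G e v = trans (deg-++ G (e ∷ []) v) (cong (deg G v +_) (+-identityʳ (incid v e)))

deg-pathEdges-suc : ∀ m v →
  deg (pathEdges (suc (suc m))) v ≡ deg (pathEdges (suc m)) v + incid v (suc m , suc (suc m))
deg-pathEdges-suc m v = trans (cong (λ G → deg G v) path-∷ʳ) (deg-∷ʳ (pathEdges (suc m)) _ v)
  where
  edge : ℕ → Edge
  edge k = suc k , suc (suc k)
  path-∷ʳ : pathEdges (suc (suc m)) ≡ pathEdges (suc m) ++ edge m ∷ []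
  path-∷ʳ = trans (cong (map edge) (sym (upTo-∷ʳ m))) (map-++ edge (upTo m) (m ∷ []))

deg-path-beyond : ∀ m v → suc m < v → deg (pathEdges (suc m)) v ≡ 0
deg-path-beyond zero    v _     = refl
deg-path-beyond (suc m) v 2+m<v = begin
  deg (pathEdges (suc (suc m))) v                           ≡⟨ deg-pathEdges-suc m v ⟩
  deg (pathEdges (suc m)) v + incid v (suc m , suc (suc m)) ≡⟨ cong₂ _+_ ih (incid-≢ _ _ v (<⇒≢ 1+m<v) (<⇒≢ 2+m<v)) ⟩
  0                                                         ∎
  where
  open ≡-Reasoning
  1+m<v = <-trans (n<1+n (suc m)) 2+m<v
  ih = deg-path-beyond m v 1+m<v

deg-path-first : ∀ m → deg (pathEdges (suc (suc m))) 1 ≡ 1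
deg-path-first zero    = refl
deg-path-first (suc m) = trans (deg-pathEdges-suc (suc m) 1) (cong (_+ 0) (deg-path-first m))

deg-path-last : ∀ m → deg (pathEdges (suc (suc m))) (suc (suc m)) ≡ 1
deg-path-last m = trans (deg-pathEdges-suc m (suc (suc m)))
  (cong₂ _+_ (deg-path-beyond m (suc (suc m)) ≤-refl) (incid-snd≢fst (suc m) (suc (suc m)) (<⇒≢ ≤-refl)))

deg-path-inner : ∀ m v → 2 ≤ v → v ≤ m → deg (pathEdges (suc m)) v ≡ 2
deg-path-inner zero    (suc (suc _)) _ ()
deg-path-inner (suc m) v 2≤v v≤1+m with m≤n⇒m<n∨m≡n v≤1+m
... | inj₁ v<1+m = trans (deg-pathEdges-suc m v)
        (cong₂ _+_ (deg-path-inner m v 2≤v (s≤s⁻¹ v<1+m))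
                   (incid-≢ (suc m) (suc (suc m)) v (≢-sym (<⇒≢ v<1+m)) (≢-sym (<⇒≢ (m<n⇒m<1+n v<1+m)))))
deg-path-inner (suc zero) _ (s≤s ()) _ | inj₂ refl
deg-path-inner (suc (suc m)) _ _ _ | inj₂ refl = trans (deg-pathEdges-suc (suc m) (suc (suc m)))
        (cong₂ _+_ (deg-path-last m) (incid-fst≢snd (suc (suc m)) (suc (suc (suc m))) (≢-sym (<⇒≢ ≤-refl))))

cycleEdges : ℕ → List Edge
cycleEdges n = pathEdges n ++ (1 , n) ∷ []

-- For n = 1 the closing edge is a loop, which counts twice.
deg-cycle : ∀ n v → 1 ≤ v → v ≤ n → deg (cycleEdges n) v ≡ 2
deg-cycle zero    (suc _) _   ()
deg-cycle (suc m) v       1≤v v≤n = trans (deg-∷ʳ (pathEdges (suc m)) (1 , suc m) v) (path+closing m v 1≤v v≤n)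
  where
  path+closing : ∀ k u → 1 ≤ u → u ≤ suc k → deg (pathEdges (suc k)) u + incid u (1 , suc k) ≡ 2
  path+closing zero    (suc zero)    _ _ = refl
  path+closing zero    (suc (suc _)) _ (s≤s ())
  path+closing (suc k) (suc zero)    _ _ = cong (_+ 1) (deg-path-first k)
  path+closing (suc k) (suc (suc w)) _ u≤2+k with m≤n⇒m<n∨m≡n u≤2+k
  ... | inj₁ u<2+k = cong₂ _+_ (deg-path-inner (suc k) (suc (suc w)) (s≤s (s≤s z≤n)) (s≤s⁻¹ u<2+k))
                               (incid-≢ 1 (suc (suc k)) (suc (suc w)) (λ ()) (≢-sym (<⇒≢ u<2+k)))
  ... | inj₂ refl  = cong₂ _+_ (deg-path-last w) (incid-snd≢fst 1 (suc (suc w)) (λ ()))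

addIfDeg2-fires : ∀ G a b → deg G a ≡ 2 → addIfDeg2 G a b ≡ G ++ (a , b) ∷ []
addIfDeg2-fires G a b deg≡2 rewrite deg≡2 = refl

addIfDeg2-skips : ∀ G a b → deg G a ≢ 2 → addIfDeg2 G a b ≡ G
addIfDeg2-skips G a b deg≢2 rewrite ≢⇒≡ᵇ≡false deg≢2 = refl

deg-addIfDeg2-fires : ∀ G a b v → deg G a ≡ 2 → deg (addIfDeg2 G a b) v ≡ deg G v + incid v (a , b)
deg-addIfDeg2-fires G a b v deg≡2 = trans (cong (λ H → deg H v) (addIfDeg2-fires G a b deg≡2)) (deg-∷ʳ G _ v)

deg-addIfDeg2-mono : ∀ G a b v → deg G v ≤ deg (addIfDeg2 G a b) v
deg-addIfDeg2-mono G a b v with deg G a ≟ 2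
... | yes deg≡2 = ≤-trans (m≤m+n _ _) (≤-reflexive (sym (deg-addIfDeg2-fires G a b v deg≡2)))
... | no  deg≢2 = ≤-reflexive (cong (λ H → deg H v) (sym (addIfDeg2-skips G a b deg≢2)))

deg-addIfDeg2-self : ∀ G a b → 2 ≤ deg G a → 3 ≤ deg (addIfDeg2 G a b) a
deg-addIfDeg2-self G a b 2≤deg with deg G a ≟ 2
... | yes deg≡2 = ≤-trans (+-mono-≤ 2≤deg (incid-fst-≥1 a b))
                          (≤-reflexive (sym (deg-addIfDeg2-fires G a b a deg≡2)))
... | no  deg≢2 = ≤-trans (≤∧≢⇒< 2≤deg (≢-sym deg≢2)) (deg-addIfDeg2-mono G a b a)

deg-addIfDeg2-target : ∀ G a b → deg G a ≡ 2 → suc (deg G b) ≤ deg (addIfDeg2 G a b) b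
deg-addIfDeg2-target G a b deg≡2 = ≤-trans
  (subst (_≤ deg G b + incid b (a , b)) (+-comm (deg G b) 1) (+-monoʳ-≤ (deg G b) (incid-snd-≥1 a b)))
  (≤-reflexive (sym (deg-addIfDeg2-fires G a b b deg≡2)))

deg-addIfDeg2-avoid : ∀ G a b v → a ≢ v → b ≢ v → deg (addIfDeg2 G a b) v ≡ deg G v
deg-addIfDeg2-avoid G a b v a≢v b≢v with deg G a ≟ 2
... | yes deg≡2 = trans (deg-addIfDeg2-fires G a b v deg≡2)
                        (trans (cong (deg G v +_) (incid-≢ a b v a≢v b≢v)) (+-identityʳ _))
... | no  deg≢2 = cong (λ H → deg H v) (addIfDeg2-skips G a b deg≢2)

half≡⌊n/2⌋ : ∀ n → half n ≡ ⌊ n /2⌋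
half≡⌊n/2⌋ zero          = refl
half≡⌊n/2⌋ (suc zero)    = refl
half≡⌊n/2⌋ (suc (suc n)) = trans (m/n≡1+[m∸n]/n {suc (suc n)} {2} (s≤s (s≤s z≤n))) (cong suc (half≡⌊n/2⌋ n))

halfCeil≡⌈n/2⌉ : ∀ n → halfCeil n ≡ ⌈ n /2⌉
halfCeil≡⌈n/2⌉ n = trans (half≡⌊n/2⌋ (n + 1)) (cong ⌊_/2⌋ (+-comm n 1))

⌈n/2⌉≤1+⌊n/2⌋ : ∀ n → ⌈ n /2⌉ ≤ suc ⌊ n /2⌋
⌈n/2⌉≤1+⌊n/2⌋ zero          = z≤n
⌈n/2⌉≤1+⌊n/2⌋ (suc zero)    = s≤s z≤n
⌈n/2⌉≤1+⌊n/2⌋ (suc (suc n)) = s≤s (⌈n/2⌉≤1+⌊n/2⌋ n)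

half≤halfCeil : ∀ n → half n ≤ halfCeil n
half≤halfCeil n = subst₂ _≤_ (sym (half≡⌊n/2⌋ n)) (sym (halfCeil≡⌈n/2⌉ n)) (⌊n/2⌋≤⌈n/2⌉ n)

half+half≤n : ∀ n → half n + half n ≤ n
half+half≤n n = begin
  half n + half n   ≤⟨ +-monoʳ-≤ (half n) (half≤halfCeil n) ⟩
  half n + halfCeil n ≡⟨ cong₂ _+_ (half≡⌊n/2⌋ n) (halfCeil≡⌈n/2⌉ n) ⟩
  ⌊ n /2⌋ + ⌈ n /2⌉   ≡⟨ ⌊n/2⌋+⌈n/2⌉≡n n ⟩
  n                   ∎
  where open ≤-Reasoning

n≤1+half+half : ∀ n → n ≤ suc (half n + half n)
n≤1+half+half n = begin
  n                        ≡⟨ sym (⌊n/2⌋+⌈n/2⌉≡n n) ⟩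
  ⌊ n /2⌋ + ⌈ n /2⌉        ≤⟨ +-monoʳ-≤ ⌊ n /2⌋ (⌈n/2⌉≤1+⌊n/2⌋ n) ⟩
  ⌊ n /2⌋ + suc ⌊ n /2⌋    ≡⟨ +-suc ⌊ n /2⌋ ⌊ n /2⌋ ⟩
  suc (⌊ n /2⌋ + ⌊ n /2⌋)  ≡⟨ cong (λ h → suc (h + h)) (sym (half≡⌊n/2⌋ n)) ⟩
  suc (half n + half n)    ∎
  where open ≤-Reasoning

half≤n : ∀ n → half n ≤ n
half≤n n = ≤-trans (m≤m+n (half n) (half n)) (half+half≤n n)

upper-vertex : ∀ n v → half n < v → v < n → ∃[ j ] suc j ≤ half n × half n + suc j ≡ v
upper-vertex n v h<v v<n = j , j<h , trans (+-suc (half n) j) (m+[n∸m]≡n h<v)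
  where
  j = v ∸ suc (half n)
  j<h : j < half n
  j<h = +-cancelˡ-< (suc (half n)) j (half n) (begin-strict
    suc (half n) + j   ≡⟨ m+[n∸m]≡n h<v ⟩
    v                  <⟨ v<n ⟩
    n                  ≤⟨ n≤1+half+half n ⟩
    suc (half n + half n) ∎)
    where open ≤-Reasoning

range : ℕ → List ℕ
range j = map suc (upTo j)

stage : ℕ → ℕ → List Edge
stage n j = loop n (cycleEdges n) (range j)

loop-++ : ∀ n G is is′ → loop n G (is ++ is′) ≡ loop n (loop n G is) is′
loop-++ n G []       is′ = refl
loop-++ n G (i ∷ is) is′ = loop-++ n _ is is′

stage-suc : ∀ n j → stage n (suc j) ≡ addIfDeg2 (stage n j) (suc j) (half n + suc j)
stage-suc n j = begin
  loop n (cycleEdges n) (map suc (upTo (suc j)))          ≡⟨ cong (loop n (cycleEdges n)) range-∷ʳ ⟩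
  loop n (cycleEdges n) (range j ++ suc j ∷ [])          ≡⟨ loop-++ n (cycleEdges n) (range j) (suc j ∷ []) ⟩
  addIfDeg2 (stage n j) (suc j) (half n + suc j)         ∎
  where
  open ≡-Reasoning
  range-∷ʳ : range (suc j) ≡ range j ++ suc j ∷ []
  range-∷ʳ = trans (cong (map suc) (sym (upTo-∷ʳ j))) (map-++ suc (upTo j) (j ∷ []))

deg-stage-suc-mono : ∀ n j v → deg (stage n j) v ≤ deg (stage n (suc j)) v
deg-stage-suc-mono n j v = subst (λ G → deg (stage n j) v ≤ deg G v) (sym (stage-suc n j))
  (deg-addIfDeg2-mono (stage n j) (suc j) (half n + suc j) v)

deg-stage-mono : ∀ n {i j} v → i ≤′ j → deg (stage n i) v ≤ deg (stage n j) v
deg-stage-mono n v ≤′-refl                = ≤-refl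
deg-stage-mono n v (≤′-step {j} i≤′j) = ≤-trans (deg-stage-mono n v i≤′j) (deg-stage-suc-mono n j v)

deg-stage-≥2 : ∀ n j v → 1 ≤ v → v ≤ n → 2 ≤ deg (stage n j) v
deg-stage-≥2 n j v 1≤v v≤n =
  subst (_≤ deg (stage n j) v) (deg-cycle n v 1≤v v≤n) (deg-stage-mono n {0} {j} v (≤⇒≤′ z≤n))

deg-stage-≤-final : ∀ n j v → j ≤ halfCeil n → deg (stage n j) v ≤ deg (pathAugmentation n) v
deg-stage-≤-final n j v j≤c = ≤-trans (deg-stage-mono n {j} {halfCeil n} v (≤⇒≤′ j≤c))
  (deg-addIfDeg2-mono (stage n (halfCeil n)) n (half n + 1) v)

-- Steps 1, …, j only touch vertices ≤ j and > ⌊n/2⌋.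
deg-stage-untouched : ∀ n j v → j < v → v ≤ half n → deg (stage n j) v ≡ deg (cycleEdges n) v
deg-stage-untouched n zero    v _   _   = refl
deg-stage-untouched n (suc j) v j<v v≤h = begin
  deg (stage n (suc j)) v                                  ≡⟨ cong (λ G → deg G v) (stage-suc n j) ⟩
  deg (addIfDeg2 (stage n j) (suc j) (half n + suc j)) v   ≡⟨ deg-addIfDeg2-avoid (stage n j) _ _ v (<⇒≢ j<v) h+j≢v ⟩
  deg (stage n j) v                                        ≡⟨ deg-stage-untouched n j v (<-trans (n<1+n j) j<v) v≤h ⟩
  deg (cycleEdges n) v                                     ∎
  where
  open ≡-Reasoning
  h+j≢v : half n + suc j ≢ v
  h+j≢v = ≢-sym (<⇒≢ (≤-<-trans v≤h (m<m+n (half n) (s≤s z≤n))))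

deg-lower-≥3 : ∀ n j → suc j ≤ half n → 3 ≤ deg (pathAugmentation n) (suc j)
deg-lower-≥3 n j 1+j≤h =
  ≤-trans step (deg-stage-≤-final n (suc j) (suc j) (≤-trans 1+j≤h (half≤halfCeil n)))
  where
  1+j≤n = ≤-trans 1+j≤h (half≤n n)
  step : 3 ≤ deg (stage n (suc j)) (suc j)
  step = subst (λ G → 3 ≤ deg G (suc j)) (sym (stage-suc n j))
    (deg-addIfDeg2-self (stage n j) (suc j) (half n + suc j) (deg-stage-≥2 n j (suc j) (s≤s z≤n) 1+j≤n))

deg-upper-≥3 : ∀ n j → suc j ≤ half n → 3 ≤ deg (pathAugmentation n) (half n + suc j)
deg-upper-≥3 n j 1+j≤h =
  ≤-trans step (deg-stage-≤-final n (suc j) (half n + suc j) (≤-trans 1+j≤h (half≤halfCeil n)))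
  where
  1+j≤n = ≤-trans 1+j≤h (half≤n n)
  1≤h+1+j = ≤-trans (s≤s z≤n) (m≤n+m (suc j) (half n))
  h+1+j≤n = ≤-trans (+-monoʳ-≤ (half n) 1+j≤h) (half+half≤n n)
  deg≡2 : deg (stage n j) (suc j) ≡ 2
  deg≡2 = trans (deg-stage-untouched n j (suc j) ≤-refl 1+j≤h) (deg-cycle n (suc j) (s≤s z≤n) 1+j≤n)
  step : 3 ≤ deg (stage n (suc j)) (half n + suc j)
  step = subst (λ G → 3 ≤ deg G (half n + suc j)) (sym (stage-suc n j))
    (≤-trans (s≤s (deg-stage-≥2 n j (half n + suc j) 1≤h+1+j h+1+j≤n))
             (deg-addIfDeg2-target (stage n j) (suc j) (half n + suc j) deg≡2))

deg-last-≥3 : ∀ n → 1 ≤ n → 3 ≤ deg (pathAugmentation n) n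
deg-last-≥3 n 1≤n =
  deg-addIfDeg2-self (stage n (halfCeil n)) n (half n + 1) (deg-stage-≥2 n (halfCeil n) n 1≤n ≤-refl)

pathAugmentation-deg≥3 : ∀ n v → 1 ≤ v → v ≤ n → 3 ≤ deg (pathAugmentation n) v
pathAugmentation-deg≥3 n (suc j) 1≤v v≤n with suc j ≟ n | suc j ≤? half n
... | yes refl | _       = deg-last-≥3 (suc j) 1≤v
... | no  v≢n  | yes v≤h = deg-lower-≥3 n j v≤h
... | no  v≢n  | no  v≰h with upper-vertex n (suc j) (≰⇒> v≰h) (≤∧≢⇒< v≤n v≢n)
...   | i , 1+i≤h , h+1+i≡v =
  subst (λ w → 3 ≤ deg (pathAugmentation n) w) h+1+i≡v (deg-upper-≥3 n i 1+i≤h)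

lemma2 : (n : ℕ) → 4 ≤ n → (v : ℕ) → 1 ≤ v → v ≤ n →
    3 ≤ deg (pathAugmentation n) v
lemma2 n _ = pathAugmentation-deg≥3 n
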